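{- Let $A\in\mathcal C_4(G_n)$. Then (1) $a(A)+b(A)=n+1$; (2) $c(A)+d(A)=b(A)$; (3) $c(A)+2d(A)=2a(A)-2$; (4) $3b(A)+d(A)=3c(A)+4d(A)=2n$.
   Context: Fix $n\ge5$. $G_n$ is a simple plane triangulation having two non-adjacent vertices $a,b$ of degree $n$ (the poles) and $2n$ vertices of degree $5$. $N_a,N_b$ are the cycles induced by the neighbours of $a$ and $b$. An edge is of type 1 if one end lies on $N_a$ and the other on $N_b$, of type 2 if it is an edge of $N_a$ or $N_b$. $\mathcal C_4(G_n)$ is the set of 4-colourings $V(G_n)\to\{1,2,3,4\}$; $A(i,j)$ is the subgraph induced by the vertices coloured $i$ or $j$. Convention: a 4-colouring in which both poles have the same colour exists only when $3\mid n$ and is then unique up to permutation of colours; it is denoted $Q$. Every other 4-colouring is normalized, by permuting colours, so that the poles receive colours 1 and 2. For $A\neq Q$: $a(A)$ = number of vertices coloured 1, $b(A)$ = number of vertices coloured 3, $c(A)$ = number of type-2 edges in $A(3,4)$, $d(A)$ = number of type-1 edges in $A(1,2)$. For $Q$: $a(Q)=\frac n3+1$, $b(Q)=c(Q)=\frac{2n}3$, $d(Q)=0$. -}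

module Defs where

open import Data.Nat using (ℕ; suc; _+_; _*_; NonZero)
open import Data.Nat.DivMod using (_mod_; _/_)
open import Data.Fin using (Fin; toℕ) renaming (zero to c1; suc to fs)
open import Data.Fin.Properties using () renaming (_≟_ to _≟ᶠ_)
open import Data.List using (List; []; _∷_; _++_; map; filter; length; concatMap; allFin)
open import Data.List.Membership.Propositional using (_∈_)
open import Data.Product using (_×_; _,_; proj₁; proj₂)
open import Data.Sum using (_⊎_)
open import Relation.Binary.PropositionalEquality using (_≡_; _≢_)
open import Relation.Nullary using (Dec; yes; no; ¬_)
open import Relation.Nullary.Decidable using (⌊_⌋)
open import Data.Bool using (Bool; true; false; if_then_else_; _∧_)

-- Vertices of G_n: the two poles a, b; the cycle N_a = u_0 … u_{n-1};
-- the cycle N_b = w_0 … w_{n-1}.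
data V (n : ℕ) : Set where
  pa pb : V n
  u w   : Fin n → V n

next : ∀ {n} .{{_ : NonZero n}} → Fin n → Fin n
next {n} i = suc (toℕ i) mod n

allV : ∀ n → List (V n)
allV n = pa ∷ pb ∷ (map u (allFin n) ++ map w (allFin n))

type2 : ∀ n .{{_ : NonZero n}} → List (V n × V n)
type2 n = map (λ i → u i , u (next i)) (allFin n) ++ map (λ i → w i , w (next i)) (allFin n)

type1 : ∀ n .{{_ : NonZero n}} → List (V n × V n)
type1 n = map (λ i → u i , w i) (allFin n) ++ map (λ i → u i , w (next i)) (allFin n)

spokes : ∀ n → List (V n × V n)
spokes n = map (λ i → pa , u i) (allFin n) ++ map (λ i → pb , w i) (allFin n)

edges : ∀ n .{{_ : NonZero n}} → List (V n × V n)
edges n = spokes n ++ type2 n ++ type1 n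

-- colours 1,2,3,4 are represented by the elements 0,1,2,3 of Fin 4
Colour : Set
Colour = Fin 4

col1 col2 col3 col4 : Colour
col1 = c1
col2 = fs c1
col3 = fs (fs c1)
col4 = fs (fs (fs c1))

Is4Colouring : ∀ n .{{_ : NonZero n}} → (V n → Colour) → Set
Is4Colouring n κ = ∀ {e} → e ∈ edges n → κ (proj₁ e) ≢ κ (proj₂ e)

QOrNormalised : ∀ {n} → (V n → Colour) → Set
QOrNormalised κ =
  (κ pa ≡ κ pb) ⊎ ((κ pa ≡ col1 × κ pb ≡ col2) ⊎ (κ pa ≡ col2 × κ pb ≡ col1))

isQ : ∀ {n} → (V n → Colour) → Bool
isQ κ = ⌊ κ pa ≟ᶠ κ pb ⌋

in12 : Colour → Bool
in12 x = ⌊ x ≟ᶠ col1 ⌋ Data.Bool.∨ ⌊ x ≟ᶠ col2 ⌋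

in34 : Colour → Bool
in34 x = ⌊ x ≟ᶠ col3 ⌋ Data.Bool.∨ ⌊ x ≟ᶠ col4 ⌋

countColour : ∀ n → (V n → Colour) → Colour → ℕ
countColour n κ k = length (filter (λ v → κ v ≟ᶠ k) (allV n))

countEdges : ∀ {n} → (V n → Colour) → (Colour → Bool) → List (V n × V n) → ℕ
countEdges κ P es = length (Data.List.filterᵇ (λ e → P (κ (proj₁ e)) ∧ P (κ (proj₂ e))) es)

aInv bInv cInv dInv : ∀ n .{{_ : NonZero n}} → (V n → Colour) → ℕ
aInv n κ = if isQ κ then n / 3 + 1 else countColour n κ col1
bInv n κ = if isQ κ then (2 * n) / 3 else countColour n κ col3
cInv n κ = if isQ κ then (2 * n) / 3 else countEdges κ in34 (type2 n)
dInv n κ = if isQ κ then 0 else countEdges κ in12 (type1 n)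

-- Write the neighbours of a as u_i and those of b as w_i, so that the strip
-- between N_a and N_b consists of the triangles u_i w_i w_{i+1} and
-- u_i u_{i+1} w_{i+1}. Every invariant is a sum over the n windows
-- (w_i, u_i, w_{i+1}, u_{i+1}) of a quantity depending only on the colours of
-- the window, and two such sums agree as soon as the summands agree on every
-- properly coloured window up to a telescoping term φ(w_{i+1}, u_{i+1}) −
-- φ(w_i, u_i). A window has finitely many colourings, so these local identities
-- are checked exhaustively. When both poles have the same colour this shows
-- 3 ∣ n, and the conventional values of a, b, c, d satisfy the identities.
-- Otherwise it gives (1), (2) and 3b + d = 2n, and the remaining identities
-- are linear consequences of these.
module Submission where

open import Defs
open import Data.Nat using (ℕ; zero; suc; _+_; _*_; _∸_; _%_; _/_; _≤_; s≤s; NonZero)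
open import Data.Nat.Properties
  using (_≟_; +-comm; +-assoc; +-identityʳ; *-identityˡ; *-identityʳ; *-suc; *-comm; *-distribˡ-+; +-cancelʳ-≡; +-*-semiring)
open import Data.Nat.DivMod using (m<n⇒m%n≡m; n%n≡0; m*n/n≡m)
open import Data.Nat.Tactic.RingSolver using (solve-∀)
open import Data.Fin using (Fin; toℕ; inject₁; fromℕ) renaming (zero to fzero; suc to fsuc)
open import Data.Fin.Properties using (toℕ-injective; toℕ-fromℕ<; toℕ-inject₁; toℕ-fromℕ; toℕ<n; all?)
  renaming (_≟_ to _≟ᶠ_)
open import Data.List using (List; []; _∷_; _++_; map; filter; length; tabulate; allFin)
open import Data.List.Properties using (filter-++; length-++; map-tabulate)
open import Data.List.Membership.Propositional using (_∈_)
open import Data.List.Membership.Propositional.Properties using (∈-map⁺; ∈-++⁺ˡ; ∈-++⁺ʳ; ∈-allFin)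
open import Data.List.Relation.Unary.All as All using (All; []; _∷_)
open import Data.List.Relation.Unary.All.Properties using (map⁺)
open import Data.Vec using (Vec; []; _∷_; lookup)
open import Data.Bool using (Bool; true; false; if_then_else_; _∧_; T?)
open import Data.Product using (_×_; _,_; proj₁; proj₂; uncurry)
open import Data.Sum using (inj₁; inj₂)
open import Function using (_∘_)
open import Relation.Nullary using (Dec; does; ¬?; map′)
open import Relation.Nullary.Decidable using (True; toWitness; _→-dec_; isYes≗does; dec-true; dec-false)
open import Relation.Binary.PropositionalEquality
open import Algebra.Properties.Semiring.Sum +-*-semiring
  using (sum; sum-syntax; ∑-distrib-+; *-distribˡ-sum; sum-cong-≗; sum-init-last)

𝟙 : Bool → ℕ
𝟙 true  = 1
𝟙 false = 0

sum-const : ∀ n k → ∑[ i < n ] k ≡ n * k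
sum-const zero    k = refl
sum-const (suc n) k = cong (k +_) (sum-const n k)

next-inject₁ : ∀ {m} (i : Fin m) → next {suc m} (inject₁ i) ≡ fsuc i
next-inject₁ {m} i = toℕ-injective (begin
  toℕ (next (inject₁ i))       ≡⟨ toℕ-fromℕ< _ ⟩
  suc (toℕ (inject₁ i)) % suc m ≡⟨ cong (λ k → suc k % suc m) (toℕ-inject₁ i) ⟩
  suc (toℕ i) % suc m          ≡⟨ m<n⇒m%n≡m (s≤s (toℕ<n i)) ⟩
  suc (toℕ i)                  ∎)
  where open ≡-Reasoning

next-fromℕ : ∀ m → next {suc m} (fromℕ m) ≡ fzero
next-fromℕ m = toℕ-injective (begin
  toℕ (next (fromℕ m))         ≡⟨ toℕ-fromℕ< _ ⟩
  suc (toℕ (fromℕ m)) % suc m  ≡⟨ cong (λ k → suc k % suc m) (toℕ-fromℕ m) ⟩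
  suc m % suc m                ≡⟨ n%n≡0 (suc m) ⟩
  0                            ∎)
  where open ≡-Reasoning

sum-∘-next : ∀ {n} .{{_ : NonZero n}} (f : Fin n → ℕ) → sum (f ∘ next) ≡ sum f
sum-∘-next {zero}  f = refl
sum-∘-next {suc m} f = begin
  sum (f ∘ next)                           ≡⟨ sum-init-last (f ∘ next) ⟩
  sum (f ∘ next ∘ inject₁) + f (next (fromℕ m))
    ≡⟨ cong₂ _+_ (sum-cong-≗ (cong f ∘ next-inject₁)) (cong f (next-fromℕ m)) ⟩
  sum (f ∘ fsuc) + f fzero                 ≡⟨ +-comm _ (f fzero) ⟩
  sum f                                    ∎
  where open ≡-Reasoning

∑-telescope : ∀ {n} .{{_ : NonZero n}} (f g φ : Fin n → ℕ) →
              (∀ i → f i + φ i ≡ g i + φ (next i)) → sum f ≡ sum g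
∑-telescope f g φ step = +-cancelʳ-≡ (sum φ) (sum f) (sum g) (begin
  sum f + sum φ                    ≡⟨ ∑-distrib-+ f φ ⟨
  ∑[ i < _ ] (f i + φ i)           ≡⟨ sum-cong-≗ step ⟩
  ∑[ i < _ ] (g i + φ (next i))    ≡⟨ ∑-distrib-+ g (φ ∘ next) ⟩
  sum g + sum (φ ∘ next)           ≡⟨ cong (sum g +_) (sum-∘-next φ) ⟩
  sum g + sum φ                    ∎)
  where open ≡-Reasoning

module _ {A : Set} {P : A → Set} (P? : (x : A) → Dec (P x)) where

  length-filter-∷ : ∀ x xs → length (filter P? (x ∷ xs)) ≡ 𝟙 (does (P? x)) + length (filter P? xs)
  length-filter-∷ x xs with does (P? x)
  ... | true  = refl
  ... | false = refl

  length-filter-tabulate : ∀ {n} (f : Fin n → A) →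
                           length (filter P? (tabulate f)) ≡ ∑[ i < n ] 𝟙 (does (P? (f i)))
  length-filter-tabulate {zero}  f = refl
  length-filter-tabulate {suc n} f = begin
    length (filter P? (tabulate f))
      ≡⟨ length-filter-∷ (f fzero) (tabulate (f ∘ fsuc)) ⟩
    𝟙 (does (P? (f fzero))) + length (filter P? (tabulate (f ∘ fsuc)))
      ≡⟨ cong (𝟙 (does (P? (f fzero))) +_) (length-filter-tabulate (f ∘ fsuc)) ⟩
    ∑[ i < suc n ] 𝟙 (does (P? (f i)))
      ∎
    where open ≡-Reasoning

  length-filter-map-allFin-++ : ∀ {n} (f g : Fin n → A) →
    length (filter P? (map f (allFin n) ++ map g (allFin n)))
      ≡ ∑[ i < n ] (𝟙 (does (P? (f i))) + 𝟙 (does (P? (g i))))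
  length-filter-map-allFin-++ {n} f g = begin
    length (filter P? (map f (allFin n) ++ map g (allFin n)))
      ≡⟨ cong length (filter-++ P? (map f (allFin n)) (map g (allFin n))) ⟩
    length (filter P? (map f (allFin n)) ++ filter P? (map g (allFin n)))
      ≡⟨ length-++ (filter P? (map f (allFin n))) ⟩
    length (filter P? (map f (allFin n))) + length (filter P? (map g (allFin n)))
      ≡⟨ cong₂ _+_ (count f) (count g) ⟩
    ∑[ i < n ] 𝟙 (does (P? (f i))) + ∑[ i < n ] 𝟙 (does (P? (g i)))
      ≡⟨ ∑-distrib-+ (λ i → 𝟙 (does (P? (f i)))) (λ i → 𝟙 (does (P? (g i)))) ⟨
    ∑[ i < n ] (𝟙 (does (P? (f i))) + 𝟙 (does (P? (g i))))
      ∎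
    where
    open ≡-Reasoning
    count : (h : Fin n → A) → length (filter P? (map h (allFin n))) ≡ ∑[ i < n ] 𝟙 (does (P? (h i)))
    count h = trans (cong (length ∘ filter P?) (map-tabulate (λ i → i) h)) (length-filter-tabulate h)

record Window : Set where
  constructor ⟨_,_,_,_⟩
  field
    w₀ u₀ w₁ u₁ : Colour

open Window

windowShape : {A : Set} → A → A → A → A → A → A → List (A × A)
windowShape a b w₀ u₀ w₁ u₁ =
  (u₀ , w₀) ∷ (u₀ , w₁) ∷ (w₀ , w₁) ∷ (u₀ , u₁) ∷ (u₁ , w₁) ∷
  (a , u₀) ∷ (a , u₁) ∷ (b , w₀) ∷ (b , w₁) ∷ []

Admissible : Colour → Colour → Window → Set
Admissible P R W = All (uncurry _≢_) (windowShape P R (w₀ W) (u₀ W) (w₁ W) (u₁ W))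

admissible? : ∀ P R W → Dec (Admissible P R W)
admissible? P R W = All.all? (λ e → ¬? (proj₁ e ≟ᶠ proj₂ e)) _

∀-window? : {Q : Window → Set} → (∀ W → Dec (Q W)) → Dec (∀ W → Q W)
∀-window? Q? = map′ (λ q W → q (w₀ W) (u₀ W) (w₁ W) (u₁ W)) (λ q x y x′ y′ → q ⟨ x , y , x′ , y′ ⟩)
  (all? λ x → all? λ y → all? λ x′ → all? λ y′ → Q? ⟨ x , y , x′ , y′ ⟩)

Potential : Set
Potential = Colour → Colour → ℕ

Telescoping : Colour → Colour → (F G : Window → ℕ) → Potential → Set
Telescoping P R F G φ =
  ∀ W → Admissible P R W → F W + φ (w₀ W) (u₀ W) ≡ G W + φ (w₁ W) (u₁ W)

telescoping? : ∀ P R F G φ → Dec (Telescoping P R F G φ)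
telescoping? P R F G φ = ∀-window? λ W →
  admissible? P R W →-dec (F W + φ (w₀ W) (u₀ W) ≟ G W + φ (w₁ W) (u₁ W))

record Telescopes (P R : Colour) (F G : Window → ℕ) : Set where
  constructor _by_
  field
    potential   : Potential
    telescoping : Telescoping P R F G potential

colourCount : Colour → Window → ℕ
colourCount k W = 𝟙 (does (u₀ W ≟ᶠ k)) + 𝟙 (does (w₀ W ≟ᶠ k))

type2Count34 : Window → ℕ
type2Count34 W = 𝟙 (in34 (u₀ W) ∧ in34 (u₁ W)) + 𝟙 (in34 (w₀ W) ∧ in34 (w₁ W))

type1Count12 : Window → ℕ
type1Count12 W = 𝟙 (in12 (u₀ W) ∧ in12 (w₀ W)) + 𝟙 (in12 (u₀ W) ∧ in12 (w₁ W))

module _ {n : ℕ} .{{_ : NonZero n}} (κ : V n → Colour) where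

  window : Fin n → Window
  window i = ⟨ κ (w i) , κ (u i) , κ (w (next i)) , κ (u (next i)) ⟩

  windowEdges : Fin n → List (V n × V n)
  windowEdges i = windowShape pa pb (w i) (u i) (w (next i)) (u (next i))

  private
    module _ {A : Set} (f g : Fin n → A) (i : Fin n) where
      ∈-left : f i ∈ map f (allFin n) ++ map g (allFin n)
      ∈-left = ∈-++⁺ˡ (∈-map⁺ f (∈-allFin i))

      ∈-right : g i ∈ map f (allFin n) ++ map g (allFin n)
      ∈-right = ∈-++⁺ʳ (map f (allFin n)) (∈-map⁺ g (∈-allFin i))

    ∈-type1 : ∀ {e} → e ∈ type1 n → e ∈ edges n
    ∈-type1 = ∈-++⁺ʳ (spokes n) ∘ ∈-++⁺ʳ (type2 n)

    ∈-type2 : ∀ {e} → e ∈ type2 n → e ∈ edges n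
    ∈-type2 = ∈-++⁺ʳ (spokes n) ∘ ∈-++⁺ˡ

    ∈-spokes : ∀ {e} → e ∈ spokes n → e ∈ edges n
    ∈-spokes = ∈-++⁺ˡ

  windowEdges⊆edges : ∀ i → All (_∈ edges n) (windowEdges i)
  windowEdges⊆edges i =
    ∈-type1 (∈-left uw uw′ i) ∷ ∈-type1 (∈-right uw uw′ i) ∷
    ∈-type2 (∈-right uu ww i) ∷ ∈-type2 (∈-left uu ww i) ∷ ∈-type1 (∈-left uw uw′ (next i)) ∷
    ∈-spokes (∈-left au bw i) ∷ ∈-spokes (∈-left au bw (next i)) ∷
    ∈-spokes (∈-right au bw i) ∷ ∈-spokes (∈-right au bw (next i)) ∷ []
    where
    uw uw′ uu ww au bw : Fin n → V n × V n
    uw  j = u j , w j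
    uw′ j = u j , w (next j)
    uu  j = u j , u (next j)
    ww  j = w j , w (next j)
    au  j = pa , u j
    bw  j = pb , w j

  window-admissible : Is4Colouring n κ → ∀ i → Admissible (κ pa) (κ pb) (window i)
  window-admissible proper i = map⁺ (All.map proper (windowEdges⊆edges i))

  ∑-window-telescoping : Is4Colouring n κ → ∀ {F G} → Telescopes (κ pa) (κ pb) F G →
                         ∑[ i < n ] F (window i) ≡ ∑[ i < n ] G (window i)
  ∑-window-telescoping proper {F} {G} (φ by local) =
    ∑-telescope (F ∘ window) (G ∘ window) (λ i → φ (κ (w i)) (κ (u i)))
      (λ i → local (window i) (window-admissible proper i))

  ∑-window-telescoping-const : Is4Colouring n κ → ∀ {F k} → Telescopes (κ pa) (κ pb) F (λ _ → k) →
                               ∑[ i < n ] F (window i) ≡ k * n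
  ∑-window-telescoping-const proper local =
    trans (∑-window-telescoping proper local) (trans (sum-const n _) (*-comm n _))

  countColour-windows : ∀ k → countColour n κ k ≡
    𝟙 (does (κ pa ≟ᶠ k)) + 𝟙 (does (κ pb ≟ᶠ k)) + ∑[ i < n ] colourCount k (window i)
  countColour-windows k = begin
    countColour n κ k
      ≡⟨ length-filter-∷ P? pa _ ⟩
    𝟙 (does (P? pa)) + length (filter P? (pb ∷ vertices))
      ≡⟨ cong (𝟙 (does (P? pa)) +_) (length-filter-∷ P? pb vertices) ⟩
    𝟙 (does (P? pa)) + (𝟙 (does (P? pb)) + length (filter P? vertices))
      ≡⟨ +-assoc (𝟙 (does (P? pa))) _ _ ⟨
    𝟙 (does (P? pa)) + 𝟙 (does (P? pb)) + length (filter P? vertices)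
      ≡⟨ cong (𝟙 (does (P? pa)) + 𝟙 (does (P? pb)) +_) (length-filter-map-allFin-++ P? u w) ⟩
    𝟙 (does (P? pa)) + 𝟙 (does (P? pb)) + ∑[ i < n ] colourCount k (window i)
      ∎
    where
    open ≡-Reasoning
    P? : ∀ v → Dec (κ v ≡ k)
    P? v = κ v ≟ᶠ k
    vertices : List (V n)
    vertices = map u (allFin n) ++ map w (allFin n)

  countEdges-type2-windows : countEdges κ in34 (type2 n) ≡ ∑[ i < n ] type2Count34 (window i)
  countEdges-type2-windows =
    length-filter-map-allFin-++ (λ e → T? (in34 (κ (proj₁ e)) ∧ in34 (κ (proj₂ e))))
      (λ i → u i , u (next i)) (λ i → w i , w (next i))

  countEdges-type1-windows : countEdges κ in12 (type1 n) ≡ ∑[ i < n ] type1Count12 (window i)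
  countEdges-type1-windows =
    length-filter-map-allFin-++ (λ e → T? (in12 (κ (proj₁ e)) ∧ in12 (κ (proj₂ e))))
      (λ i → u i , w i) (λ i → u i , w (next i))

Identities : ℕ → ℕ → ℕ → ℕ → ℕ → Set
Identities n a b c d =
  (a + b ≡ n + 1) × (c + d ≡ b) × (c + 2 * d ≡ 2 * a ∸ 2) × (3 * b + d ≡ 2 * n) × (3 * c + 4 * d ≡ 2 * n)

Identities-resp : ∀ {n a b c d a′ b′ c′ d′} → a ≡ a′ → b ≡ b′ → c ≡ c′ → d ≡ d′ →
                  Identities n a′ b′ c′ d′ → Identities n a b c d
Identities-resp refl refl refl refl ids = ids

identities : ∀ {n A B C D} → A + B ≡ n → C + D ≡ B → 3 * B + D ≡ 2 * n →
             Identities n (suc A) B C D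
identities {A = A} {C = C} {D} refl refl 3b+d =
  sym (+-comm (A + (C + D)) 1) , refl , c+2d , 3b+d , trans (regroup-c-d C D) 3b+d
  where
  open ≡-Reasoning
  regroup-c-d : ∀ C D → 3 * C + 4 * D ≡ 3 * (C + D) + D
  regroup-c-d = solve-∀
  regroup-c-2d : ∀ C D → C + 2 * D + 2 * (C + D) ≡ 3 * (C + D) + D
  regroup-c-2d = solve-∀
  c+2d : C + 2 * D ≡ 2 * suc A ∸ 2
  c+2d = begin
    C + 2 * D    ≡⟨ +-cancelʳ-≡ (2 * (C + D)) _ _ (begin
      C + 2 * D + 2 * (C + D)   ≡⟨ regroup-c-2d C D ⟩
      3 * (C + D) + D           ≡⟨ 3b+d ⟩
      2 * (A + (C + D))         ≡⟨ *-distribˡ-+ 2 A (C + D) ⟩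
      2 * A + 2 * (C + D)       ∎) ⟩
    2 * A        ≡⟨ cong (_∸ 2) (*-suc 2 A) ⟨
    2 * suc A ∸ 2 ∎

identities-multiple-of-3 : ∀ {n} K → n ≡ 3 * K → Identities n (n / 3 + 1) ((2 * n) / 3) ((2 * n) / 3) 0
identities-multiple-of-3 K refl =
  Identities-resp a≡ b≡ b≡ refl (identities {A = K} (K+2K≡3K K) (+-identityʳ (2 * K)) (6K≡2[3K] K))
  where
  K+2K≡3K : ∀ K → K + 2 * K ≡ 3 * K
  K+2K≡3K = solve-∀
  6K≡2[3K] : ∀ K → 3 * (2 * K) + 0 ≡ 2 * (3 * K)
  6K≡2[3K] = solve-∀
  2[3K]≡2K*3 : ∀ K → 2 * (3 * K) ≡ 2 * K * 3
  2[3K]≡2K*3 = solve-∀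
  a≡ : 3 * K / 3 + 1 ≡ suc K
  a≡ = trans (cong (λ m → m / 3 + 1) (*-comm 3 K)) (trans (cong (_+ 1) (m*n/n≡m K 3)) (+-comm K 1))
  b≡ : 2 * (3 * K) / 3 ≡ 2 * K
  b≡ = trans (cong (_/ 3) (2[3K]≡2K*3 K)) (m*n/n≡m (2 * K) 3)

-- Potentials solving the finite linear systems behind (1), (2) and 3b + d = 2n
-- over the admissible windows; row w, column u.
fromTable : Vec (Vec ℕ 4) 4 → Potential
fromTable t x y = lookup (lookup t x) y

by-table : ∀ {P R F G} (t : Vec (Vec ℕ 4) 4) → True (telescoping? P R F G (fromTable t)) →
           Telescopes P R F G
by-table t valid = fromTable t by toWitness valid

record Normalisation (P R : Colour) : Set where
  field
    poles-distinct      : P ≢ R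
    one-pole-coloured-1 : 𝟙 (does (P ≟ᶠ col1)) + 𝟙 (does (R ≟ᶠ col1)) ≡ 1
    no-pole-coloured-3  : 𝟙 (does (P ≟ᶠ col3)) + 𝟙 (does (R ≟ᶠ col3)) ≡ 0
    local-a+b           : Telescopes P R (λ W → colourCount col1 W + colourCount col3 W) (λ _ → 1)
    local-c+d           : Telescopes P R (λ W → type2Count34 W + type1Count12 W) (colourCount col3)
    local-3b+d          : Telescopes P R (λ W → 3 * colourCount col3 W + type1Count12 W) (λ _ → 2)

normalisation₁₂ : Normalisation col1 col2
normalisation₁₂ = record
  { poles-distinct      = λ ()
  ; one-pole-coloured-1 = refl
  ; no-pole-coloured-3  = refl
  ; local-a+b           = by-table
      ((0 ∷ 0 ∷ 0 ∷ 0 ∷ []) ∷ (0 ∷ 0 ∷ 0 ∷ 0 ∷ []) ∷ (0 ∷ 0 ∷ 0 ∷ 0 ∷ []) ∷ (0 ∷ 1 ∷ 0 ∷ 0 ∷ []) ∷ []) _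
  ; local-c+d           = by-table
      ((0 ∷ 0 ∷ 1 ∷ 1 ∷ []) ∷ (0 ∷ 0 ∷ 0 ∷ 0 ∷ []) ∷ (0 ∷ 1 ∷ 0 ∷ 1 ∷ []) ∷ (0 ∷ 0 ∷ 1 ∷ 0 ∷ []) ∷ []) _
  ; local-3b+d          = by-table
      ((0 ∷ 2 ∷ 2 ∷ 2 ∷ []) ∷ (0 ∷ 0 ∷ 0 ∷ 0 ∷ []) ∷ (0 ∷ 0 ∷ 0 ∷ 1 ∷ []) ∷ (0 ∷ 3 ∷ 1 ∷ 0 ∷ []) ∷ []) _
  }

normalisation₂₁ : Normalisation col2 col1
normalisation₂₁ = record
  { poles-distinct      = λ ()
  ; one-pole-coloured-1 = refl
  ; no-pole-coloured-3  = refl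
  ; local-a+b           = by-table
      ((0 ∷ 0 ∷ 0 ∷ 0 ∷ []) ∷ (1 ∷ 0 ∷ 1 ∷ 1 ∷ []) ∷ (0 ∷ 0 ∷ 0 ∷ 1 ∷ []) ∷ (1 ∷ 0 ∷ 1 ∷ 0 ∷ []) ∷ []) _
  ; local-c+d           = by-table
      ((0 ∷ 0 ∷ 0 ∷ 0 ∷ []) ∷ (0 ∷ 0 ∷ 1 ∷ 1 ∷ []) ∷ (1 ∷ 0 ∷ 0 ∷ 1 ∷ []) ∷ (0 ∷ 0 ∷ 1 ∷ 0 ∷ []) ∷ []) _
  ; local-3b+d          = by-table
      ((0 ∷ 0 ∷ 0 ∷ 0 ∷ []) ∷ (2 ∷ 0 ∷ 2 ∷ 2 ∷ []) ∷ (0 ∷ 0 ∷ 0 ∷ 1 ∷ []) ∷ (3 ∷ 0 ∷ 1 ∷ 0 ∷ []) ∷ []) _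
  }

-- With both poles coloured c, the strip is 3-coloured by the other colours and
-- column i + 1 is (the third colour, w_i); so the position (0 in w, 1 in u,
-- 2 absent) of a fixed colour x ≠ c in the column advances cyclically.
otherColour : Colour → Colour
otherColour fzero    = col2
otherColour (fsuc _) = col1

phase : Colour → Potential
phase c x y = if does (x ≟ᶠ otherColour c) then 0 else if does (y ≟ᶠ otherColour c) then 1 else 2

wraps : Colour → Window → ℕ
wraps c W = 𝟙 (does (phase c (w₀ W) (u₀ W) ≟ 2))

phase-advances : ∀ {c c′} → c ≡ c′ → Telescopes c c′ (λ _ → 1) (λ W → 3 * wraps c W)
phase-advances {c} refl =
  phase c by toWitness {a? = all? λ c → telescoping? c c (λ _ → 1) (λ W → 3 * wraps c W) (phase c)} _ c

module _ {n : ℕ} .{{_ : NonZero n}} (κ : V n → Colour) (proper : Is4Colouring n κ) where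

  private
    if-false : ∀ {b} {x y : ℕ} → b ≡ false → (if b then x else y) ≡ y
    if-false refl = refl

    if-true : ∀ {b} {x y : ℕ} → b ≡ true → (if b then x else y) ≡ x
    if-true refl = refl

    isQ-false : κ pa ≢ κ pb → isQ κ ≡ false
    isQ-false poles≢ = trans (isYes≗does (κ pa ≟ᶠ κ pb)) (dec-false (κ pa ≟ᶠ κ pb) poles≢)

    isQ-true : κ pa ≡ κ pb → isQ κ ≡ true
    isQ-true poles≡ = trans (isYes≗does (κ pa ≟ᶠ κ pb)) (dec-true (κ pa ≟ᶠ κ pb) poles≡)

  normalised-identities : ∀ {P R} → Normalisation P R → κ pa ≡ P → κ pb ≡ R →
                          Identities n (aInv n κ) (bInv n κ) (cInv n κ) (dInv n κ)
  normalised-identities N refl refl =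
    Identities-resp a≡ b≡ c≡ d≡ (identities {A = A} a+b c+d 3b+d)
    where
    open Normalisation N
    open ≡-Reasoning
    a′ b′ c′ d′ : Fin n → ℕ
    a′ = colourCount col1 ∘ window κ
    b′ = colourCount col3 ∘ window κ
    c′ = type2Count34 ∘ window κ
    d′ = type1Count12 ∘ window κ
    A B C D : ℕ
    A = sum a′
    B = sum b′
    C = sum c′
    D = sum d′
    not-Q : isQ κ ≡ false
    not-Q = isQ-false poles-distinct
    a≡ : aInv n κ ≡ suc A
    a≡ = trans (if-false not-Q) (trans (countColour-windows κ col1) (cong (_+ A) one-pole-coloured-1))
    b≡ : bInv n κ ≡ B
    b≡ = trans (if-false not-Q) (trans (countColour-windows κ col3) (cong (_+ B) no-pole-coloured-3))
    c≡ : cInv n κ ≡ C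
    c≡ = trans (if-false not-Q) (countEdges-type2-windows κ)
    d≡ : dInv n κ ≡ D
    d≡ = trans (if-false not-Q) (countEdges-type1-windows κ)
    a+b : A + B ≡ n
    a+b = begin
      A + B                      ≡⟨ ∑-distrib-+ a′ b′ ⟨
      ∑[ i < n ] (a′ i + b′ i)   ≡⟨ ∑-window-telescoping-const κ proper local-a+b ⟩
      1 * n                      ≡⟨ *-identityˡ n ⟩
      n                          ∎
    c+d : C + D ≡ B
    c+d = trans (sym (∑-distrib-+ c′ d′)) (∑-window-telescoping κ proper local-c+d)
    3b+d : 3 * B + D ≡ 2 * n
    3b+d = begin
      3 * B + D                      ≡⟨ cong (_+ D) (*-distribˡ-sum 3 b′) ⟩
      ∑[ i < n ] (3 * b′ i) + D      ≡⟨ ∑-distrib-+ (λ i → 3 * b′ i) d′ ⟨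
      ∑[ i < n ] (3 * b′ i + d′ i)   ≡⟨ ∑-window-telescoping-const κ proper local-3b+d ⟩
      2 * n                          ∎

  equal-poles-identities : κ pa ≡ κ pb → Identities n (aInv n κ) (bInv n κ) (cInv n κ) (dInv n κ)
  equal-poles-identities same =
    Identities-resp (if-true Q) (if-true Q) (if-true Q) (if-true Q) (identities-multiple-of-3 K n≡3K)
    where
    open ≡-Reasoning
    Q : isQ κ ≡ true
    Q = isQ-true same
    k′ : Fin n → ℕ
    k′ = wraps (κ pa) ∘ window κ
    K : ℕ
    K = sum k′
    n≡3K : n ≡ 3 * K
    n≡3K = begin
      n                          ≡⟨ *-identityʳ n ⟨
      n * 1                      ≡⟨ sum-const n 1 ⟨
      ∑[ i < n ] 1               ≡⟨ ∑-window-telescoping κ proper (phase-advances same) ⟩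
      ∑[ i < n ] (3 * k′ i)      ≡⟨ *-distribˡ-sum 3 k′ ⟨
      3 * K                      ∎

lemma1p3 : (n : ℕ) .{{_ : NonZero n}} → 5 ≤ n → (κ : V n → Colour) →
           Is4Colouring n κ → QOrNormalised κ →
           (aInv n κ + bInv n κ ≡ n + 1)
           × (cInv n κ + dInv n κ ≡ bInv n κ)
           × (cInv n κ + 2 * dInv n κ ≡ 2 * aInv n κ ∸ 2)
           × (3 * bInv n κ + dInv n κ ≡ 2 * n)
           × (3 * cInv n κ + 4 * dInv n κ ≡ 2 * n)
lemma1p3 n _ κ proper (inj₁ same)              = equal-poles-identities κ proper same
lemma1p3 n _ κ proper (inj₂ (inj₁ (a₁ , b₂))) = normalised-identities κ proper normalisation₁₂ a₁ b₂
lemma1p3 n _ κ proper (inj₂ (inj₂ (a₂ , b₁))) = normalised-identities κ proper normalisation₂₁ a₂ b₁
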